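{- Let $H$ be a graph, $q\in\mathbb N$, and let $M$ be a matching with $V(M)\subseteq V(H\otimes J_q)$. If there is a $q$-congested $\pi(M)$-linkage in $H$, then there is an uncongested $M$-linkage in $H\otimes J_{2q}$.
   Context: The blowup $H\otimes J_t$ has vertices $v^{(i)}$ ($v\in V(H)$, $i\in[t]$) and edges $u^{(i)}v^{(j)}$ for $uv\in E(H)$, $i,j\in[t]$, and $u^{(i)}u^{(j)}$ for $u\in V(H)$, $i\ne j$. A matching $M$ here is a set of pairwise disjoint pairs of distinct vertices (not necessarily edges), viewed as a graph on its endpoints. The $H$-projection $\pi(M)$ is the multigraph with vertex set $\{v: v^{(i)}\in V(M)\}$ and edge multiset $\{\!\{vw : v^{(i)}w^{(j)}\in M,\ v\ne w\}\!\}$ (pairs inside a single block $\{v^{(i)}\}$ are dropped). A path is a sequence of distinct vertices with consecutive ones adjacent. For a graph $H'$ and a multigraph $N$ with $V(N)\subseteq V(H')$, an $N$-linkage is a family $(P_e)_{e\in E(N)}$ of paths in $H'$ with $P_e$ having the endpoints of $e$ as endpoints; it is $r$-congested if each vertex of $H'$ lies on at most $r$ of the paths, uncongested if $r=1$. -}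

module Defs where

open import Data.Nat using (ℕ; _+_; _*_; _≤_)
open import Data.Nat.Properties using (m≤m+n)
open import Data.Fin using (Fin; inject≤)
open import Data.Fin.Properties renaming (_≟_ to _≟F_)
open import Data.Product using (_×_; _,_; proj₁; proj₂; Σ)
open import Data.Product.Properties using (≡-dec)
open import Data.Sum using (_⊎_)
open import Data.Maybe using (Maybe; just; nothing)
open import Data.List using (List; []; _∷_; length; filter; mapMaybe; concatMap; last; map)
open import Data.List.Relation.Unary.Unique.Propositional using (Unique)
open import Data.List.Relation.Unary.Linked using (Linked)
open import Data.List.Relation.Binary.Pointwise using (Pointwise)
open import Data.List.Relation.Unary.All using (All)
import Data.List.Membership.DecPropositional as DecMem
open import Relation.Binary.PropositionalEquality using (_≡_; _≢_)
open import Relation.Binary.Definitions using (DecidableEquality)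
open import Relation.Nullary using (¬_; yes; no)

record Graph (n : ℕ) : Set₁ where
  field
    Adj    : Fin n → Fin n → Set
    sym    : ∀ {u v} → Adj u v → Adj v u
    irrefl : ∀ {u} → ¬ Adj u u
open Graph public

-- Vertices of the blowup H ⊗ J_t : pairs (v , i) standing for v^(i).
BV : ℕ → ℕ → Set
BV n t = Fin n × Fin t

_≟BV_ : ∀ {n t} → DecidableEquality (BV n t)
_≟BV_ = ≡-dec _≟F_ _≟F_

BlowAdj : ∀ {n} (H : Graph n) (t : ℕ) → BV n t → BV n t → Set
BlowAdj H t (u , i) (v , j) = Adj H u v ⊎ (u ≡ v × i ≢ j)

-- A pair list viewed as a "matching": all endpoints pairwise distinct
-- (so pairs consist of distinct vertices and are pairwise disjoint).
endpoints : ∀ {A : Set} → List (A × A) → List A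
endpoints = concatMap (λ e → proj₁ e ∷ proj₂ e ∷ [])

IsMatching : ∀ {A : Set} → List (A × A) → Set
IsMatching M = Unique (endpoints M)

proj-edge : ∀ {n t} → BV n t × BV n t → Maybe (Fin n × Fin n)
proj-edge ((v , i) , (w , j)) with v ≟F w
... | yes _ = nothing
... | no _  = just (v , w)

π : ∀ {n t} → List (BV n t × BV n t) → List (Fin n × Fin n)
π = mapMaybe proj-edge

IsPath : ∀ {V : Set} (Adj : V → V → Set) → V → V → List V → Set
IsPath Adj a b p =
  Σ (List _) (λ rest → p ≡ a ∷ rest) × last p ≡ just b × Unique p × Linked Adj p

IsLinkage : ∀ {V : Set} (Adj : V → V → Set) → List (V × V) → List (List V) → Set
IsLinkage Adj N Ps = Pointwise (λ e p → IsPath Adj (proj₁ e) (proj₂ e) p) N Ps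

load : ∀ {V : Set} → DecidableEquality V → V → List (List V) → ℕ
load _≟_ x Ps = length (filter (λ p → x ∈? p) Ps)
  where open DecMem _≟_

Congested : ∀ {V : Set} → DecidableEquality V → ℕ → List (List V) → Set
Congested {V} _≟_ r Ps = (x : V) → load _≟_ x Ps ≤ r

embed : ∀ {n} (q : ℕ) → BV n q → BV n (2 * q)
embed q (v , i) = v , inject≤ i (m≤m+n q (q + 0))

embedM : ∀ {n} (q : ℕ) → List (BV n q × BV n q) → List (BV n (2 * q) × BV n (2 * q))
embedM q = map (λ e → embed q (proj₁ e) , embed q (proj₂ e))

{-# OPTIONS --safe #-}
module Submission where

-- Terminals of M keep their copies v^(i) with i < q, and the projected paths are lifted
-- vertex by vertex into the upper copies: a path of Ps puts each inner vertex y on the copy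
-- y^(q+ℓ), where ℓ counts the later paths of Ps through y. By q-congestion ℓ < q, distinct
-- paths through y use distinct copies, and lifted paths never meet the terminals. A pair
-- inside one block v^(i), v^(j) is joined by the edge of the clique J.

open import Defs hiding (sym)
open import Data.Nat using (ℕ; _*_; _+_; _≤_; _<_; suc; z≤n; _<?_)
open import Data.Nat.Properties
  using (≤-refl; ≤-trans; ≤-reflexive; ≤-<-trans; n≤1+n; m≤m+n; +-identityʳ; +-monoʳ-≤; +-monoʳ-<; <⇒≱; <-irrefl)
open import Data.Fin using (Fin; toℕ; _↑ʳ_; fromℕ<)
open import Data.Fin.Properties using (_≟_; toℕ-inject≤; toℕ-↑ʳ; toℕ-fromℕ<; inject≤-injective; toℕ<n)
open import Data.Product using (_×_; Σ; _,_; proj₁; proj₂)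
open import Data.Sum using (inj₁; inj₂)
open import Data.List using (List; []; _∷_; map; length)
open import Data.List.Properties using (last-map; filter-accept; filter-none)
import Data.Maybe as Maybe
open import Function using (_∘_)
open import Relation.Nullary using (¬_; yes; no; contradiction)
open import Relation.Binary.PropositionalEquality using (_≡_; _≢_; refl; sym; trans; cong; cong₂; subst; subst₂)
open import Relation.Binary.Definitions using (DecidableEquality)
open import Data.List.Relation.Unary.Any using (Any; here; there)
open import Data.List.Relation.Unary.All as All using (All; []; _∷_; lookupAny)
open import Data.List.Relation.Unary.All.Properties using (¬Any⇒All¬)
import Data.List.Relation.Unary.All.Properties as AllP
open import Data.List.Relation.Unary.AllPairs using ([]; _∷_)
open import Data.List.Relation.Binary.Pointwise using ([]; _∷_)
import Data.List.Relation.Unary.Linked as Linked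
open import Data.List.Relation.Unary.Linked using ([-]; _∷_)
import Data.List.Relation.Unary.Linked.Properties as LinkedP
import Data.List.Relation.Unary.Unique.Propositional.Properties as UniqueP
open import Data.List.Membership.Propositional using (_∈_)
open import Data.List.Membership.Propositional.Properties using (∈-map⁻)
import Data.List.Membership.DecPropositional as DecMembership

module _ {V : Set} (_≟v_ : DecidableEquality V) where
  open DecMembership _≟v_ using (_∈?_)

  load-∷-∈ : ∀ {x P} Ps → x ∈ P → load _≟v_ x (P ∷ Ps) ≡ suc (load _≟v_ x Ps)
  load-∷-∈ {x} Ps x∈P = cong length (filter-accept (x ∈?_) x∈P)

  load-≤-∷ : ∀ x P Ps → load _≟v_ x Ps ≤ load _≟v_ x (P ∷ Ps)
  load-≤-∷ x P Ps with x ∈? P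
  ... | yes _ = n≤1+n _
  ... | no _  = ≤-refl

  load≡0 : ∀ {x} Ps → ¬ Any (x ∈_) Ps → load _≟v_ x Ps ≡ 0
  load≡0 {x} Ps x∉Ps = cong length (filter-none (x ∈?_) (¬Any⇒All¬ Ps x∉Ps))

  congested-∷⁻ : ∀ {r P Ps} → Congested _≟v_ r (P ∷ Ps) → Congested _≟v_ r Ps
  congested-∷⁻ {P = P} {Ps} congested x = ≤-trans (load-≤-∷ x P Ps) (congested x)

  congested-∷⇒load< : ∀ {r x P Ps} → Congested _≟v_ r (P ∷ Ps) → x ∈ P → load _≟v_ x Ps < r
  congested-∷⇒load< {r} {x} {P} {Ps} congested x∈P =
    subst (_≤ r) (load-∷-∈ Ps x∈P) (congested x)

  uncongested-∷ : ∀ {Q Qs} → Congested _≟v_ 1 Qs → (∀ {x} → x ∈ Q → ¬ Any (x ∈_) Qs) →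
                  Congested _≟v_ 1 (Q ∷ Qs)
  uncongested-∷ {Q} {Qs} uncongested disjoint x with x ∈? Q
  ... | yes x∈Q = ≤-reflexive (cong suc (load≡0 Qs (disjoint x∈Q)))
  ... | no _    = uncongested x

module _ {n : ℕ} (H : Graph n) {t : ℕ} where

  lift-path : (c : Fin n → Fin t) → ∀ {a b P} → IsPath (Adj H) a b P →
              IsPath (BlowAdj H t) (a , c a) (b , c b) (map (λ x → x , c x) P)
  lift-path c {P = P} ((rest , refl) , last≡b , unique , linked) =
    (map lift rest , refl) ,
    trans (last-map lift P) (cong (Maybe.map lift) last≡b) ,
    UniqueP.map⁺ (cong proj₁) unique ,
    LinkedP.map⁺ (Linked.map inj₁ linked)
    where
    lift : Fin n → BV n t
    lift x = x , c x

  copies-path : ∀ {v i j} → i ≢ j → IsPath (BlowAdj H t) (v , i) (v , j) ((v , i) ∷ (v , j) ∷ [])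
  copies-path i≢j =
    (_ , refl) , refl , ((i≢j ∘ cong proj₂) ∷ []) ∷ [] ∷ [] , inj₂ (refl , i≢j) ∷ [-]

module _ {n : ℕ} (q : ℕ) where

  copyIndex : BV n (2 * q) → ℕ
  copyIndex x = toℕ (proj₂ x)

  copyIndex-embed< : ∀ a → copyIndex (embed q a) < q
  copyIndex-embed< (v , i) = subst (_< q) (sym (toℕ-inject≤ i _)) (toℕ<n i)

  embed-injective : ∀ {a a′} → embed q a ≡ embed {n} q a′ → a ≡ a′
  embed-injective {v , i} {v′ , i′} eq =
    cong₂ _,_ (cong proj₁ eq) (inject≤-injective _ _ i i′ (cong proj₂ eq))

  Terminals : List (BV n q × BV n q) → List (BV n (2 * q))
  Terminals M = map (embed q) (endpoints M)

  IsRelay : List (List (Fin n)) → BV n (2 * q) → Set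
  IsRelay Ps x = q ≤ copyIndex x × copyIndex x < q + load _≟_ (proj₁ x) Ps

  data Allowed (M : List (BV n q × BV n q)) (Ps : List (List (Fin n))) (x : BV n (2 * q)) : Set where
    terminal : x ∈ Terminals M → Allowed M Ps x
    relay    : IsRelay Ps x → Allowed M Ps x

  Confined : List (BV n q × BV n q) → List (List (Fin n)) → List (List (BV n (2 * q))) → Set
  Confined M Ps = All (All (Allowed M Ps))

  -- Ps are the projected paths lifted so far, Ps′ these together with the new one.
  data Slot (s t : BV n (2 * q)) (Ps Ps′ : List (List (Fin n))) : BV n (2 * q) → Set where
    source : Slot s t Ps Ps′ s
    target : Slot s t Ps Ps′ t
    fresh  : ∀ {x} → copyIndex x ≡ q + load _≟_ (proj₁ x) Ps →
             load _≟_ (proj₁ x) Ps < load _≟_ (proj₁ x) Ps′ → Slot s t Ps Ps′ x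

  embed-unallowed : ∀ {a M Ps} → All (a ≢_) (endpoints M) → ¬ Allowed M Ps (embed q a)
  embed-unallowed a∉M (terminal t) with ∈-map⁻ (embed q) t
  ... | a′ , a′∈M , eq = All.lookup a∉M a′∈M (embed-injective eq)
  embed-unallowed {a} a∉M (relay (q≤ , _)) = <⇒≱ (copyIndex-embed< a) q≤

  relay-unallowed : ∀ {x M Ps} → copyIndex x ≡ q + load _≟_ (proj₁ x) Ps → ¬ Allowed M Ps x
  relay-unallowed eq (terminal t) with ∈-map⁻ (embed q) t
  ... | a , _ , refl = <⇒≱ (copyIndex-embed< a) (≤-trans (m≤m+n q _) (≤-reflexive (sym eq)))
  relay-unallowed eq (relay (_ , below)) = <-irrefl eq below

  unallowed-unused : ∀ {x M Ps Qs} → Confined M Ps Qs → ¬ Allowed M Ps x → ¬ Any (x ∈_) Qs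
  unallowed-unused confined unallowed x∈Qs with lookupAny confined x∈Qs
  ... | allowed , x∈Q = unallowed (All.lookup allowed x∈Q)

  slot-unallowed : ∀ {a b M Ps Ps′ x} → All (a ≢_) (endpoints M) → All (b ≢_) (endpoints M) →
                   Slot (embed q a) (embed q b) Ps Ps′ x → ¬ Allowed M Ps x
  slot-unallowed a∉M b∉M source       = embed-unallowed a∉M
  slot-unallowed a∉M b∉M target       = embed-unallowed b∉M
  slot-unallowed a∉M b∉M (fresh eq _) = relay-unallowed eq

  slot-allowed : ∀ {a b M Ps Ps′ x} → Slot (embed q a) (embed q b) Ps Ps′ x →
                 Allowed ((a , b) ∷ M) Ps′ x
  slot-allowed source           = terminal (here refl)
  slot-allowed target           = terminal (there (here refl))
  slot-allowed (fresh eq load<) =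
    relay (≤-trans (m≤m+n q _) (≤-reflexive (sym eq)) , ≤-<-trans (≤-reflexive eq) (+-monoʳ-< q load<))

  allowed-weaken : ∀ {e M Ps Ps′ x} → (∀ y → load _≟_ y Ps ≤ load _≟_ y Ps′) →
                   Allowed M Ps x → Allowed (e ∷ M) Ps′ x
  allowed-weaken Ps≤Ps′ (terminal t)         = terminal (there (there t))
  allowed-weaken Ps≤Ps′ (relay (q≤ , below)) = relay (q≤ , ≤-trans below (+-monoʳ-≤ q (Ps≤Ps′ _)))

  confined-∷ : ∀ {a b M Ps Ps′ Q Qs} → IsMatching ((a , b) ∷ M) →
               (∀ y → load _≟_ y Ps ≤ load _≟_ y Ps′) →
               All (Slot (embed q a) (embed q b) Ps Ps′) Q →
               Confined M Ps Qs → Congested _≟BV_ 1 Qs →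
               Confined ((a , b) ∷ M) Ps′ (Q ∷ Qs) × Congested _≟BV_ 1 (Q ∷ Qs)
  confined-∷ ((_ ∷ a∉M) ∷ b∉M ∷ _) Ps≤Ps′ slots confined uncongested =
    All.map slot-allowed slots ∷ All.map (All.map (allowed-weaken Ps≤Ps′)) confined ,
    uncongested-∷ _≟BV_ uncongested
      (λ x∈Q → unallowed-unused confined (slot-unallowed a∉M b∉M (All.lookup slots x∈Q)))

  -- The fallback d is never used on a lifted path, where loads stay below q.
  relayCopy : Fin (2 * q) → ℕ → Fin (2 * q)
  relayCopy d k with k <? q
  ... | yes k<q = q ↑ʳ fromℕ< (subst (k <_) (sym (+-identityʳ q)) k<q)
  ... | no _    = d

  toℕ-relayCopy : ∀ d {k} → k < q → toℕ (relayCopy d k) ≡ q + k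
  toℕ-relayCopy d {k} k<q with k <? q
  ... | yes _   = trans (toℕ-↑ʳ q _) (cong (q +_) (toℕ-fromℕ< _))
  ... | no k≮q = contradiction k<q k≮q

  copyOf : (v w : Fin n) (i j : Fin (2 * q)) → List (List (Fin n)) → Fin n → Fin (2 * q)
  copyOf v w i j Ps y with y ≟ v | y ≟ w
  ... | yes _ | _     = i
  ... | no _  | yes _ = j
  ... | no _  | no _  = relayCopy i (load _≟_ y Ps)

  copyOf-source : ∀ v w i j Ps → copyOf v w i j Ps v ≡ i
  copyOf-source v w i j Ps with v ≟ v | v ≟ w
  ... | yes _   | _ = refl
  ... | no v≢v | _ = contradiction refl v≢v

  copyOf-target : ∀ {v w} i j Ps → v ≢ w → copyOf v w i j Ps w ≡ j
  copyOf-target {v} {w} i j Ps v≢w with w ≟ v | w ≟ w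
  ... | yes w≡v | _      = contradiction (sym w≡v) v≢w
  ... | no _    | yes _   = refl
  ... | no _    | no w≢w = contradiction refl w≢w

  copyOf-slot : ∀ v w i j {P} Ps {y} → y ∈ P → load _≟_ y Ps < q →
                Slot (v , i) (w , j) Ps (P ∷ Ps) (y , copyOf v w i j Ps y)
  copyOf-slot v w i j Ps {y} y∈P load<q with y ≟ v | y ≟ w
  ... | yes refl | _        = source
  ... | no _     | yes refl = target
  ... | no _     | no _     = fresh (toℕ-relayCopy i load<q) (≤-reflexive (sym (load-∷-∈ _≟_ Ps y∈P)))

  liftedPath : (v w : Fin n) (i j : Fin (2 * q)) → List (List (Fin n)) → List (Fin n) → List (BV n (2 * q))
  liftedPath v w i j Ps = map (λ y → y , copyOf v w i j Ps y)

  liftedPath-slots : ∀ {v w i j P Ps} → Congested _≟_ q (P ∷ Ps) →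
                     All (Slot (v , i) (w , j) Ps (P ∷ Ps)) (liftedPath v w i j Ps P)
  liftedPath-slots {v} {w} {i} {j} {Ps = Ps} congested =
    AllP.map⁺ (All.tabulate λ y∈P → copyOf-slot v w i j Ps y∈P (congested-∷⇒load< _≟_ {Ps = Ps} congested y∈P))

module _ {n : ℕ} (H : Graph n) (q : ℕ) where

  liftedPath-isPath : ∀ {v w P} i j Ps → v ≢ w → IsPath (Adj H) v w P →
                      IsPath (BlowAdj H (2 * q)) (v , i) (w , j) (liftedPath q v w i j Ps P)
  liftedPath-isPath {v} {w} {P} i j Ps v≢w path =
    subst₂ (λ s t → IsPath (BlowAdj H (2 * q)) s t (liftedPath q v w i j Ps P))
      (cong (v ,_) (copyOf-source q v w i j Ps)) (cong (w ,_) (copyOf-target q i j Ps v≢w))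
      (lift-path H (copyOf q v w i j Ps) path)

  lift-linkage : ∀ M Ps → IsMatching M → IsLinkage (Adj H) (π M) Ps → Congested _≟_ q Ps →
                 Σ (List (List (BV n (2 * q)))) λ Qs →
                   IsLinkage (BlowAdj H (2 * q)) (embedM q M) Qs × Confined q M Ps Qs × Congested _≟BV_ 1 Qs
  lift-linkage [] [] _ [] _ = [] , [] , [] , λ _ → z≤n
  lift-linkage (((v , i) , (w , j)) ∷ M) Ps matching@((a≢b ∷ _) ∷ _ ∷ matchingM) linkage congested
    with v ≟ w
  ... | yes refl
    with Qs , linkageQs , confined , uncongested ← lift-linkage M Ps matchingM linkage congested =
    _ ∷ Qs ,
    copies-path H (a≢b ∘ embed-injective q ∘ cong (v ,_)) ∷ linkageQs ,
    confined-∷ q matching (λ _ → ≤-refl) (source ∷ target ∷ []) confined uncongested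
  ... | no v≢w with Ps | linkage
  ... | P ∷ Ps′ | pathP ∷ linkage′
    with Qs , linkageQs , confined , uncongested
           ← lift-linkage M Ps′ matchingM linkage′ (congested-∷⁻ _≟_ {P = P} congested) =
    liftedPath q v w i′ j′ Ps′ P ∷ Qs ,
    liftedPath-isPath i′ j′ Ps′ v≢w pathP ∷ linkageQs ,
    confined-∷ q matching (λ y → load-≤-∷ _≟_ y P Ps′) (liftedPath-slots q congested) confined uncongested
    where
    i′ j′ : Fin (2 * q)
    i′ = proj₂ (embed q (v , i))
    j′ = proj₂ (embed q (w , j))

lemma9 : {n : ℕ} (H : Graph n) (q : ℕ) (M : List (BV n q × BV n q)) →
         IsMatching M →
         Σ (List (List (Fin n))) (λ Ps → IsLinkage (Adj H) (π M) Ps × Congested _≟_ q Ps) →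
         Σ (List (List (BV n (2 * q)))) (λ Qs →
           IsLinkage (BlowAdj H (2 * q)) (embedM q M) Qs × Congested _≟BV_ 1 Qs)
lemma9 H q M matching (Ps , linkage , congested)
  with Qs , linkageQs , _ , uncongested ← lift-linkage H q M Ps matching linkage congested =
  Qs , linkageQs , uncongested
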